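{- For every $(d,n)\in\mathbb{N}^2$, $m(c(d,n))=m(c(n,d))$.
   Context: Let $A=\begin{pmatrix}1&1\\1&2\end{pmatrix}$, $B=\begin{pmatrix}2&1\\1&1\end{pmatrix}$, and for $w=x_1\cdots x_k\in\{a,b\}^\star$ let $M^w=M^{x_1}\cdots M^{x_k}$ with $M^a=A$, $M^b=B$ ($M^w=I$ for the empty word); $m(w)=\begin{pmatrix}1&0\end{pmatrix}M^w\begin{pmatrix}0\\1\end{pmatrix}$. A word is identified with the lattice path from $(0,0)$ with $a$ = step $(1,0)$, $b$ = step $(0,1)$. For $(d,n)\in\mathbb{N}^2$, $c(n,d)$ is the unique lattice path from $(0,0)$ to $(d,n)$ lying weakly below the segment from $(0,0)$ to $(d,n)$, containing every lattice point of this segment, and such that the region between the path and the segment contains no points of $\mathbb{N}^2$ other than those of the path (equivalently the $\gcd(d,n)$-th power of the lower Christoffel word of slope $n/d$). Thus $c(d,n)$ is the corresponding path from $(0,0)$ to $(n,d)$. -}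

module Defs where

open import Data.Nat using (ℕ; zero; suc; _+_; _*_; _≤_; _<_; _≤?_; _<?_)
open import Data.List using (List; []; _∷_)
open import Data.Product using (_×_; _,_)
open import Relation.Nullary using (yes; no)

-- Letters: a = step (1,0), b = step (0,1)
data Letter : Set where
  a b : Letter

Word : Set
Word = List Letter

record Mat : Set where
  constructor mat
  field
    m11 m12 m21 m22 : ℕ
open Mat public

_⊗_ : Mat → Mat → Mat
mat p q r s ⊗ mat p' q' r' s' =
  mat (p * p' + q * r') (p * q' + q * s') (r * p' + s * r') (r * q' + s * s')

I₂ : Mat
I₂ = mat 1 0 0 1

A B : Mat
A = mat 1 1 1 2
B = mat 2 1 1 1

M : Letter → Mat
M a = A
M b = B

Mw : Word → Mat
Mw [] = I₂
Mw (x ∷ w) = M x ⊗ Mw w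

-- m(w) = (1 0) M^w (0 1)^T : the top-right entry
m : Word → ℕ
m w = m12 (Mw w)

-- Christoffel path.  c n d is the lattice path from (0,0) to (d,n) which is the
-- highest lattice path lying weakly below the segment from (0,0) to (d,n).
-- A lattice point (x,y) lies weakly below that segment iff y * d ≤ x * n.
christoffelFrom : (n d fuel x y : ℕ) → Word
christoffelFrom n d zero x y = []
christoffelFrom n d (suc fuel) x y with y <? n | suc y * d ≤? x * n
... | yes _ | yes _ = b ∷ christoffelFrom n d fuel x (suc y)
... | yes _ | no _  = a ∷ christoffelFrom n d fuel (suc x) y
... | no _  | _     = a ∷ christoffelFrom n d fuel (suc x) y

c : ℕ → ℕ → Word
c n d = christoffelFrom n d (d + n) 0 0

-- Transposition across the antidiagonal, mat p q r s ↦ mat s q r p, reverses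
-- products, fixes the top-right entry and exchanges A and B; hence m is invariant
-- under reversing a word and exchanging its letters. It remains to see that c d n is
-- this mirror image of c n d. The path c n d is the unique word of its length whose
-- points all lie in a band of width one below the segment to (d , n), and the
-- half-turn of the rectangle followed by the exchange of axes maps this band onto the
-- band for (n , d), turning the path into its mirror image.
module Submission where

open import Defs
open import Data.Nat using (ℕ; zero; suc; _+_; _*_; _≤_; _<_; _≤?_; _<?_; z≤n; s≤s; >-nonZero)
open import Data.Nat.Properties
open import Data.Nat.Tactic.RingSolver using (solve-∀)
open import Data.List using ([]; _∷_; _++_; [_]; _∷ʳ_; reverse; map; length)
open import Data.List.Properties using (length-reverse; length-map; unfold-reverse)
open import Data.Product using (_×_; _,_; proj₁; proj₂)
open import Data.Unit using (⊤; tt)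
open import Data.Empty using (⊥; ⊥-elim)
open import Relation.Nullary using (yes; no)
open import Relation.Binary.PropositionalEquality using (_≡_; refl; sym; trans; cong; cong₂; subst; module ≡-Reasoning)

mat-cong : ∀ {p q r s p′ q′ r′ s′} →
           p ≡ p′ → q ≡ q′ → r ≡ r′ → s ≡ s′ → mat p q r s ≡ mat p′ q′ r′ s′
mat-cong refl refl refl refl = refl

⊗-assoc : ∀ X Y Z → (X ⊗ Y) ⊗ Z ≡ X ⊗ (Y ⊗ Z)
⊗-assoc (mat p q r s) (mat p′ q′ r′ s′) (mat p″ q″ r″ s″) =
  mat-cong (entry p q p′ q′ r′ s′ p″ r″) (entry p q p′ q′ r′ s′ q″ s″)
           (entry r s p′ q′ r′ s′ p″ r″) (entry r s p′ q′ r′ s′ q″ s″)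
  where
  entry : ∀ u v p′ q′ r′ s′ x y →
          (u * p′ + v * r′) * x + (u * q′ + v * s′) * y
          ≡ u * (p′ * x + q′ * y) + v * (r′ * x + s′ * y)
  entry = solve-∀

⊗-identityˡ : ∀ X → I₂ ⊗ X ≡ X
⊗-identityˡ (mat p q r s) = mat-cong (first p r) (first q s) (second p r) (second q s)
  where
  first : ∀ x y → 1 * x + 0 * y ≡ x
  first = solve-∀
  second : ∀ x y → 0 * x + 1 * y ≡ y
  second = solve-∀

⊗-identityʳ : ∀ X → X ⊗ I₂ ≡ X
⊗-identityʳ (mat p q r s) = mat-cong (first p q) (second p q) (first r s) (second r s)
  where
  first : ∀ x y → x * 1 + y * 0 ≡ x
  first = solve-∀
  second : ∀ x y → x * 0 + y * 1 ≡ y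
  second = solve-∀

antitranspose : Mat → Mat
antitranspose (mat p q r s) = mat s q r p

antitranspose-⊗ : ∀ X Y → antitranspose (X ⊗ Y) ≡ antitranspose Y ⊗ antitranspose X
antitranspose-⊗ (mat p q r s) (mat p′ q′ r′ s′) =
  mat-cong (entry r s q′ s′) (entry p q q′ s′) (entry r s p′ r′) (entry p q p′ r′)
  where
  entry : ∀ x y z w → x * z + y * w ≡ w * y + z * x
  entry = solve-∀

swap : Letter → Letter
swap a = b
swap b = a

antitranspose-M : ∀ l → antitranspose (M l) ≡ M (swap l)
antitranspose-M a = refl
antitranspose-M b = refl

mirror : Word → Word
mirror w = reverse (map swap w)

mirror-∷ : ∀ l w → mirror (l ∷ w) ≡ mirror w ∷ʳ swap l
mirror-∷ l w = unfold-reverse (swap l) (map swap w)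

length-mirror : ∀ w → length (mirror w) ≡ length w
length-mirror w = trans (length-reverse (map swap w)) (length-map swap w)

Mw-++ : ∀ u v → Mw (u ++ v) ≡ Mw u ⊗ Mw v
Mw-++ []      v = sym (⊗-identityˡ (Mw v))
Mw-++ (l ∷ u) v = trans (cong (M l ⊗_) (Mw-++ u v)) (sym (⊗-assoc (M l) (Mw u) (Mw v)))

Mw-mirror : ∀ w → Mw (mirror w) ≡ antitranspose (Mw w)
Mw-mirror []      = refl
Mw-mirror (l ∷ w) = begin
  Mw (mirror (l ∷ w))                         ≡⟨ cong Mw (mirror-∷ l w) ⟩
  Mw (mirror w ++ [ swap l ])                 ≡⟨ Mw-++ (mirror w) [ swap l ] ⟩
  Mw (mirror w) ⊗ (M (swap l) ⊗ I₂)           ≡⟨ cong₂ _⊗_ (Mw-mirror w) (⊗-identityʳ (M (swap l))) ⟩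
  antitranspose (Mw w) ⊗ M (swap l)           ≡⟨ cong (antitranspose (Mw w) ⊗_) (sym (antitranspose-M l)) ⟩
  antitranspose (Mw w) ⊗ antitranspose (M l)  ≡⟨ sym (antitranspose-⊗ (M l) (Mw w)) ⟩
  antitranspose (Mw (l ∷ w))                  ∎
  where open ≡-Reasoning

m-mirror : ∀ w → m (mirror w) ≡ m w
m-mirror w = cong m12 (Mw-mirror w)

Point : Set
Point = ℕ × ℕ

move : Letter → Point → Point
move a (x , y) = suc x , y
move b (x , y) = x , suc y

endpoint : Point → Word → Point
endpoint s []      = s
endpoint s (l ∷ w) = endpoint (move l s) w

endpoint-∷ʳ : ∀ s w l → endpoint s (w ∷ʳ l) ≡ move l (endpoint s w)
endpoint-∷ʳ s []      l = refl
endpoint-∷ʳ s (k ∷ w) l = endpoint-∷ʳ (move k s) w l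

endpoint-sum : ∀ x y w →
               proj₁ (endpoint (x , y) w) + proj₂ (endpoint (x , y) w) ≡ x + y + length w
endpoint-sum x y []      = sym (+-identityʳ (x + y))
endpoint-sum x y (a ∷ w) = trans (endpoint-sum (suc x) y w) (sym (+-suc (x + y) (length w)))
endpoint-sum x y (b ∷ w) =
  trans (endpoint-sum x (suc y) w)
        (trans (cong (_+ length w) (+-suc x y)) (sym (+-suc (x + y) (length w))))

Stays : (Point → Set) → Point → Word → Set
Stays S s []      = ⊤
Stays S s (l ∷ w) = S (move l s) × Stays S (move l s) w

Stays-∷ʳ : ∀ S s w l → Stays S s w → S (move l (endpoint s w)) → Stays S s (w ∷ʳ l)
Stays-∷ʳ S s []      l _        Sl = Sl , tt
Stays-∷ʳ S s (k ∷ w) l (Sk , Sw) Sl = Sk , Stays-∷ʳ S (move k s) w l Sw Sl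

Stays-endpoint : ∀ S s w → S s → Stays S s w → S (endpoint s w)
Stays-endpoint S s []      Ss _         = Ss
Stays-endpoint S s (l ∷ w) _  (Sl , Sw) = Stays-endpoint S (move l s) w Sl Sw

Branchless : (Point → Set) → Set
Branchless S = ∀ s → S (move a s) → S (move b s) → ⊥

Stays-unique : ∀ S → Branchless S → ∀ s u v →
               Stays S s u → Stays S s v → length u ≡ length v → u ≡ v
Stays-unique S _  s []      []      _        _        _  = refl
Stays-unique S br s (a ∷ u) (a ∷ v) (_ , Su) (_ , Sv) eq =
  cong (a ∷_) (Stays-unique S br (move a s) u v Su Sv (suc-injective eq))
Stays-unique S br s (b ∷ u) (b ∷ v) (_ , Su) (_ , Sv) eq =
  cong (b ∷_) (Stays-unique S br (move b s) u v Su Sv (suc-injective eq))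
Stays-unique S br s (a ∷ _) (b ∷ _) (Sa , _) (Sb , _) _  = ⊥-elim (br s Sa Sb)
Stays-unique S br s (b ∷ _) (a ∷ _) (Sb , _) (Sa , _) _  = ⊥-elim (br s Sa Sb)

-- Mirrored n d (X , Y) (x , y) says (X , Y) = (n ∸ y , d ∸ x).
Mirrored : ℕ → ℕ → Point → Point → Set
Mirrored n d (X , Y) (x , y) = X + y ≡ n × Y + x ≡ d

Mirrored-move : ∀ n d l E s → Mirrored n d E (move l s) → Mirrored n d (move (swap l) E) s
Mirrored-move n d a (X , Y) (x , y) (eX , eY) = eX , trans (sym (+-suc Y x)) eY
Mirrored-move n d b (X , Y) (x , y) (eX , eY) = trans (sym (+-suc X y)) eX , eY

Stays-mirror : ∀ n d S T → (∀ E s → S s → Mirrored n d E s → T E) →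
               ∀ w s E → S s → Stays S s w → Mirrored n d E (endpoint s w) →
               Stays T E (mirror w) × Mirrored n d (endpoint E (mirror w)) s
Stays-mirror n d S T ST []      s E _  _         E↔ = tt , E↔
Stays-mirror n d S T ST (l ∷ w) s E Ss (Sl , Sw) E↔
  rewrite mirror-∷ l w | endpoint-∷ʳ E (mirror w) (swap l)
  with Stays-mirror n d S T ST w (move l s) E Sl Sw E↔
... | Tw , end↔ = Stays-∷ʳ T E (mirror w) (swap l) Tw (ST _ s Ss end↔′) , end↔′
  where
  end↔′ : Mirrored n d (move (swap l) (endpoint E (mirror w))) s
  end↔′ = Mirrored-move n d l (endpoint E (mirror w)) s end↔

-- (x , y) lies weakly below the segment from (0 , 0) to (d , n), while (x - 1 , y + 1)
-- lies strictly above it.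
Band : ℕ → ℕ → Point → Set
Band n d (x , y) = y * d ≤ x * n × x * n < y * d + (d + n)

Band-branchless : ∀ n d → Branchless (Band n d)
Band-branchless n d (x , y) (_ , above) (below , _) =
  <-irrefl refl (<-≤-trans above (≤-trans (≤-reflexive (shift y d n)) (+-monoʳ-≤ n below)))
  where
  shift : ∀ y d n → y * d + (d + n) ≡ n + (d + y * d)
  shift = solve-∀

Band-move-a : ∀ n d x y → x * n < suc y * d → Band n d (x , y) → Band n d (suc x , y)
Band-move-a n d x y room (below , _) =
  ≤-trans below (m≤n+m (x * n) n) , <-≤-trans (+-monoʳ-< n room) (≤-reflexive (shift n d y))
  where
  shift : ∀ n d y → n + (d + y * d) ≡ y * d + (d + n)
  shift = solve-∀

Band-move-b : ∀ n d x y → suc y * d ≤ x * n → Band n d (x , y) → Band n d (x , suc y)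
Band-move-b n d x y room (_ , above) = room , <-≤-trans above (+-monoˡ-≤ (d + n) (m≤n+m (y * d) d))

Band-mirror : ∀ n d E s → Band n d s → Mirrored n d E s → Band d n E
Band-mirror n d (X , Y) (x , y) (below , above) (eX , eY) = below′ , above′
  where
  balance : X * d + y * d ≡ Y * n + x * n
  balance = begin
    X * d + y * d   ≡⟨ sym (*-distribʳ-+ d X y) ⟩
    (X + y) * d     ≡⟨ cong (_* d) eX ⟩
    n * d           ≡⟨ *-comm n d ⟩
    d * n           ≡⟨ cong (_* n) (sym eY) ⟩
    (Y + x) * n     ≡⟨ *-distribʳ-+ n Y x ⟩
    Y * n + x * n   ∎
    where open ≡-Reasoning
  below′ : Y * n ≤ X * d
  below′ = +-cancelʳ-≤ (x * n) (Y * n) (X * d)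
             (≤-trans (≤-reflexive (sym balance)) (+-monoʳ-≤ (X * d) below))
  shift : ∀ u v d n → u + (v + (d + n)) ≡ u + (n + d) + v
  shift = solve-∀
  above′ : X * d < Y * n + (n + d)
  above′ = +-cancelʳ-≤ (y * d) (suc (X * d)) (Y * n + (n + d))
             (≤-trans (≤-reflexive (cong suc balance))
               (≤-trans (+-monoʳ-< (Y * n) above) (≤-reflexive (shift (Y * n) (y * d) d n))))

Band-antidiagonal : ∀ n d x y → 0 < d + n → Band n d (x , y) → x + y ≡ d + n → (x , y) ≡ (d , n)
Band-antidiagonal n d x y pos (below , above) sum =
  cong₂ _,_ (+-cancelʳ-≡ y x d (trans sum (cong (d +_) (sym y≡n)))) y≡n
  where
  total : x * n + y * n ≡ n * (d + n)
  total = trans (sym (*-distribʳ-+ n x y)) (trans (cong (_* n) sum) (*-comm (d + n) n))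
  upper : y * (d + n) ≤ n * (d + n)
  upper = begin
    y * (d + n)      ≡⟨ *-distribˡ-+ y d n ⟩
    y * d + y * n    ≤⟨ +-monoˡ-≤ (y * n) below ⟩
    x * n + y * n    ≡⟨ total ⟩
    n * (d + n)      ∎
    where open ≤-Reasoning
  shift : ∀ y d n → y * d + (d + n) + y * n ≡ suc y * (d + n)
  shift = solve-∀
  lower : n * (d + n) < suc y * (d + n)
  lower = begin-strict
    n * (d + n)                ≡⟨ sym total ⟩
    x * n + y * n              <⟨ +-monoˡ-< (y * n) above ⟩
    y * d + (d + n) + y * n    ≡⟨ shift y d n ⟩
    suc y * (d + n)            ∎
    where open ≤-Reasoning
  y≡n : y ≡ n
  y≡n = ≤-antisym (*-cancelʳ-≤ y n (d + n) ⦃ >-nonZero pos ⦄ upper)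
                  (m<1+n⇒m≤n (*-cancelʳ-< (d + n) n (suc y) lower))

christoffelFrom-length : ∀ n d f x y → length (christoffelFrom n d f x y) ≡ f
christoffelFrom-length n d zero    x y = refl
christoffelFrom-length n d (suc f) x y with y <? n | suc y * d ≤? x * n
... | yes _ | yes _ = cong suc (christoffelFrom-length n d f x (suc y))
... | yes _ | no _  = cong suc (christoffelFrom-length n d f (suc x) y)
... | no _  | _     = cong suc (christoffelFrom-length n d f (suc x) y)

suc-shiftˡ : ∀ x y f → suc x + y + f ≡ x + y + suc f
suc-shiftˡ = solve-∀

suc-shiftʳ : ∀ x y f → x + suc y + f ≡ x + y + suc f
suc-shiftʳ = solve-∀

christoffelFrom-stays : ∀ n d f x y → Band n d (x , y) → x + y + f ≡ d + n →
                        Stays (Band n d) (x , y) (christoffelFrom n d f x y)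
christoffelFrom-stays n d zero    x y _    _   = tt
christoffelFrom-stays n d (suc f) x y band sum with y <? n | suc y * d ≤? x * n
... | yes _ | yes room = band′ , christoffelFrom-stays n d f x (suc y) band′ (trans (suc-shiftʳ x y f) sum)
  where
  band′ : Band n d (x , suc y)
  band′ = Band-move-b n d x y room band
... | yes _ | no full  = band′ , christoffelFrom-stays n d f (suc x) y band′ (trans (suc-shiftˡ x y f) sum)
  where
  band′ : Band n d (suc x , y)
  band′ = Band-move-a n d x y (≰⇒> full) band
... | no y≮n | _       = band′ , christoffelFrom-stays n d f (suc x) y band′ (trans (suc-shiftˡ x y f) sum)
  where
  n≤y : n ≤ y
  n≤y = ≮⇒≥ y≮n
  x<d : x < d
  x<d = +-cancelʳ-≤ n (suc x) d (begin
    suc x + n        ≤⟨ +-monoʳ-≤ (suc x) n≤y ⟩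
    suc x + y        ≤⟨ m≤m+n (suc x + y) f ⟩
    suc x + y + f    ≡⟨ trans (suc-shiftˡ x y f) sum ⟩
    d + n            ∎)
    where open ≤-Reasoning
  room : x * n < suc y * d
  room = begin-strict
    x * n            ≤⟨ *-monoʳ-≤ x (≤-trans n≤y (n≤1+n y)) ⟩
    x * suc y        <⟨ *-monoˡ-< (suc y) x<d ⟩
    d * suc y        ≡⟨ *-comm d (suc y) ⟩
    suc y * d        ∎
    where open ≤-Reasoning
  band′ : Band n d (suc x , y)
  band′ = Band-move-a n d x y room band

c-length : ∀ n d → length (c n d) ≡ d + n
c-length n d = christoffelFrom-length n d (d + n) 0 0

c-stays : ∀ n d → 0 < d + n → Stays (Band n d) (0 , 0) (c n d)
c-stays n d pos = christoffelFrom-stays n d (d + n) 0 0 (z≤n , pos) refl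

c-endpoint : ∀ n d → 0 < d + n → endpoint (0 , 0) (c n d) ≡ (d , n)
c-endpoint n d pos =
  Band-antidiagonal n d (proj₁ (endpoint (0 , 0) (c n d))) (proj₂ (endpoint (0 , 0) (c n d))) pos
    (Stays-endpoint (Band n d) (0 , 0) (c n d) (z≤n , pos) (c-stays n d pos))
    (trans (endpoint-sum 0 0 (c n d)) (c-length n d))

c-mirror⁺ : ∀ d n → 0 < d + n → c d n ≡ mirror (c n d)
c-mirror⁺ d n pos =
  Stays-unique (Band d n) (Band-branchless d n) (0 , 0) (c d n) (mirror (c n d))
    (c-stays d n (subst (0 <_) (+-comm d n) pos)) (proj₁ mirrored)
    (trans (c-length d n) (trans (+-comm n d) (sym (trans (length-mirror (c n d)) (c-length n d)))))
  where
  mirrored : Stays (Band d n) (0 , 0) (mirror (c n d))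
           × Mirrored n d (endpoint (0 , 0) (mirror (c n d))) (0 , 0)
  mirrored = Stays-mirror n d (Band n d) (Band d n) (Band-mirror n d) (c n d) (0 , 0) (0 , 0)
               (z≤n , pos) (c-stays n d pos)
               (subst (Mirrored n d (0 , 0)) (sym (c-endpoint n d pos)) (refl , refl))

c-mirror : ∀ d n → c d n ≡ mirror (c n d)
c-mirror zero    zero    = refl
c-mirror zero    (suc n) = c-mirror⁺ zero (suc n) (s≤s z≤n)
c-mirror (suc d) n       = c-mirror⁺ (suc d) n (s≤s z≤n)

lemma2p4 : (d n : ℕ) → m (c d n) ≡ m (c n d)
lemma2p4 d n = trans (cong m (c-mirror d n)) (m-mirror (c n d))
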